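{- If $\Gamma;\Omega;\Delta\vdash M:A$, then there exists a term $N$ such that $(\Gamma,\Omega,\Delta)\vdash M\Uparrow N:A$ and $\Gamma;\Omega;\Delta\vdash N\Uparrow A$.
   Context: Strict $\lambda$-calculus over a fixed signature $\Sigma$ (atomic types $a$, constants $c{:}A$). Labels $k\in\{1,0,u\}$; types $A::=a\mid A_1\to^kA_2$; terms $c\mid x\mid\lambda x^k{:}A.M\mid M_1M_2^k$ (up to renaming of bound variables; $[N/x]M$ capture-avoiding substitution). Contexts: finite sets of declarations with distinct variables; commas denote disjoint union. Typing $\Gamma;\Omega;\Delta\vdash M:A$ ($\Gamma$ unrestricted, $\Omega$ irrelevant, $\Delta$ strict; disjoint): if $c{:}A\in\Sigma$ then $\Gamma;\Omega;\cdot\vdash c:A$; $(\Gamma,x{:}A);\Omega;\cdot\vdash x:A$; $\Gamma;\Omega;x{:}A\vdash x:A$ (no rule for $\Omega$); from $(\Gamma,x{:}A);\Omega;\Delta\vdash M:B$ infer $\Gamma;\Omega;\Delta\vdash\lambda x^u{:}A.M:A\to^uB$; from $\Gamma;(\Omega,x{:}A);\Delta\vdash M:B$ infer $\lambda x^0{:}A.M:A\to^0B$; from $\Gamma;\Omega;(\Delta,x{:}A)\vdash M:B$ infer $\lambda x^1{:}A.M:A\to^1B$; from $\Gamma;\Omega;\Delta\vdash M:A\to^uB$ and $(\Gamma,\Delta);\Omega;\cdot\vdash N:A$ infer $\Gamma;\Omega;\Delta\vdash MN^u:B$; from $\Gamma;\Omega;\Delta\vdash M:A\to^0B$ and $(\Gamma,\Omega,\Delta);\cdot;\cdot\vdash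 N:A$ infer $\Gamma;\Omega;\Delta\vdash MN^0:B$; from $(\Gamma,\Delta_N);\Omega;\Delta_M\vdash M:A\to^1B$ and $(\Gamma,\Delta_M);\Omega;\Delta_N\vdash N:A$ infer $\Gamma;\Omega;(\Delta_M,\Delta_N)\vdash MN^1:B$. Canonical/atomic forms $\Gamma;\Omega;\Delta\vdash M\Uparrow A$, $\Gamma;\Omega;\Delta\vdash M\downarrow A$ (mutually inductive): $c{:}A\in\Sigma$ gives $\Gamma;\Omega;\cdot\vdash c\downarrow A$; $(\Gamma,x{:}A);\Omega;\cdot\vdash x\downarrow A$; $\Gamma;\Omega;x{:}A\vdash x\downarrow A$; $M\downarrow a$ ($a$ atomic) gives $M\Uparrow a$ in the same contexts; the three $\lambda$ rules as for typing with $\Uparrow$ in premise and conclusion; the three application rules as for typing with the function premise and the conclusion in $\downarrow$ and the argument premise in $\Uparrow$. Conversion. Weak head reduction: $(\lambda x^k{:}A.M)N^k\to_{whr}[N/x]M$; if $M\to_{whr}Q$ then $MN^k\to_{whr}QN^k$. For a single context $\Psi$, $\Psi\vdash M\downarrow N:A$ and $\Psi\vdash M\Uparrow N:A$ are defined by: $c{:}A\in\Sigma$ gives $\Psi\vdash c\downarrow c:A$; $x{:}A\in\Psi$ gives $\Psi\vdash x\downarrow x:A$; if $M\to_{whr}M'$ and $\Psi\vdash M'\Uparrow M'':a$ then $\Psi\vdash M\Uparrow M'':a$; if $\Psi\vdash M\downarrow N:a$ then $\Psi\vdash M\Uparrow N:a$ ($a$ atomic); if $(\Psi,x{:}A)\vdash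 Mx^k\Uparrow N:B$ ($x$ fresh) then $\Psi\vdash M\Uparrow\lambda x^k{:}A.N:A\to^kB$; if $\Psi\vdash M\downarrow P:A\to^kB$ and $\Psi\vdash N\Uparrow Q:A$ then $\Psi\vdash MN^k\downarrow PQ^k:B$. $(\Gamma,\Omega,\Delta)$ denotes the union of the three contexts. -}

module Defs where

open import Data.Nat using (ℕ; zero; suc)
open import Data.Fin using (Fin; zero; suc)
open import Data.Vec using (Vec; []; _∷_; lookup; map; replicate)
open import Relation.Binary.PropositionalEquality using (_≡_; _≢_)

data Label : Set where
  l1 l0 lu : Label

data Ty (Atom : Set) : Set where
  atom  : Atom → Ty Atom
  _⇒[_]_ : Ty Atom → Label → Ty Atom → Ty Atom

record Sig : Set₁ where
  field
    Atom  : Set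
    Const : Set
    ctype : Const → Ty Atom

module _ (Sg : Sig) where
  open Sig Sg

  data Term (n : ℕ) : Set where
    const : Const → Term n
    var   : Fin n → Term n
    lam   : Label → Ty Atom → Term (suc n) → Term n
    app   : Term n → Label → Term n → Term n

  ext : ∀ {m n} → (Fin m → Fin n) → Fin (suc m) → Fin (suc n)
  ext ρ zero    = zero
  ext ρ (suc i) = suc (ρ i)

  rename : ∀ {m n} → (Fin m → Fin n) → Term m → Term n
  rename ρ (const c)   = const c
  rename ρ (var i)     = var (ρ i)
  rename ρ (lam k A M) = lam k A (rename (ext ρ) M)
  rename ρ (app M k N) = app (rename ρ M) k (rename ρ N)

  exts : ∀ {m n} → (Fin m → Term n) → Fin (suc m) → Term (suc n)
  exts σ zero    = var zero
  exts σ (suc i) = rename suc (σ i)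

  subst : ∀ {m n} → (Fin m → Term n) → Term m → Term n
  subst σ (const c)   = const c
  subst σ (var i)     = σ i
  subst σ (lam k A M) = lam k A (subst (exts σ) M)
  subst σ (app M k N) = app (subst σ M) k (subst σ N)

  -- [N/x]M where x is the outermost bound variable (index 0)
  subst0 : ∀ {n} → Term n → Fin (suc n) → Term n
  subst0 N zero    = N
  subst0 N (suc i) = var i

  _[_]₀ : ∀ {n} → Term (suc n) → Term n → Term n
  M [ N ]₀ = subst (subst0 N) M

  weaken : ∀ {n} → Term n → Term (suc n)
  weaken = rename suc

  -- Contexts Γ;Ω;Δ: a single list of declarations (the disjoint union
  -- Γ,Ω,Δ) together with a tag saying which of the three contexts each
  -- variable belongs to.
  data Mode : Set where
    U I S : Mode   -- unrestricted (Γ), irrelevant (Ω), strict (Δ)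

  modeOf : Label → Mode
  modeOf lu = U
  modeOf l0 = I
  modeOf l1 = S

  NoStrict : ∀ {n} → Vec Mode n → Set
  NoStrict μ = ∀ j → lookup μ j ≢ S

  OnlyStrict : ∀ {n} → Vec Mode n → Fin n → Set
  OnlyStrict μ i = ∀ j → lookup μ j ≡ S → j ≡ i

  -- (Γ,Δ);Ω;·  : strict variables become unrestricted
  strictToU : Mode → Mode
  strictToU S = U
  strictToU m = m

  -- Γ;Ω;(Δ_M,Δ_N) split into (Γ,Δ_N);Ω;Δ_M and (Γ,Δ_M);Ω;Δ_N
  data SplitM : Mode → Mode → Mode → Set where
    sU  : SplitM U U U
    sI  : SplitM I I I
    sSL : SplitM S S U
    sSR : SplitM S U S

  data Split : ∀ {n} → Vec Mode n → Vec Mode n → Vec Mode n → Set where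
    []  : Split [] [] []
    _∷_ : ∀ {n m mM mN} {μ μM μN : Vec Mode n} →
          SplitM m mM mN → Split μ μM μN → Split (m ∷ μ) (mM ∷ μM) (mN ∷ μN)

  data _∣_⊢_∶_ {n : ℕ} (Ψ : Vec (Ty Atom) n) (μ : Vec Mode n) : Term n → Ty Atom → Set where
    t-const : ∀ c → NoStrict μ → Ψ ∣ μ ⊢ const c ∶ ctype c
    t-varU  : ∀ i → lookup μ i ≡ U → NoStrict μ → Ψ ∣ μ ⊢ var i ∶ lookup Ψ i
    t-varS  : ∀ i → lookup μ i ≡ S → OnlyStrict μ i → Ψ ∣ μ ⊢ var i ∶ lookup Ψ i
    t-lam   : ∀ {k A B M} → (A ∷ Ψ) ∣ (modeOf k ∷ μ) ⊢ M ∶ B →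
              Ψ ∣ μ ⊢ lam k A M ∶ (A ⇒[ k ] B)
    t-appU  : ∀ {A B M N} → Ψ ∣ μ ⊢ M ∶ (A ⇒[ lu ] B) →
              Ψ ∣ map strictToU μ ⊢ N ∶ A → Ψ ∣ μ ⊢ app M lu N ∶ B
    t-app0  : ∀ {A B M N} → Ψ ∣ μ ⊢ M ∶ (A ⇒[ l0 ] B) →
              Ψ ∣ replicate n U ⊢ N ∶ A → Ψ ∣ μ ⊢ app M l0 N ∶ B
    t-app1  : ∀ {A B M N μM μN} → Split μ μM μN →
              Ψ ∣ μM ⊢ M ∶ (A ⇒[ l1 ] B) → Ψ ∣ μN ⊢ N ∶ A →
              Ψ ∣ μ ⊢ app M l1 N ∶ B

  mutual
    data _∣_⊢_⇑_ {n : ℕ} (Ψ : Vec (Ty Atom) n) (μ : Vec Mode n) : Term n → Ty Atom → Set where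
      c-atm  : ∀ {M a} → Ψ ∣ μ ⊢ M ↓ atom a → Ψ ∣ μ ⊢ M ⇑ atom a
      c-lam  : ∀ {k A B M} → (A ∷ Ψ) ∣ (modeOf k ∷ μ) ⊢ M ⇑ B →
               Ψ ∣ μ ⊢ lam k A M ⇑ (A ⇒[ k ] B)

    data _∣_⊢_↓_ {n : ℕ} (Ψ : Vec (Ty Atom) n) (μ : Vec Mode n) : Term n → Ty Atom → Set where
      a-const : ∀ c → NoStrict μ → Ψ ∣ μ ⊢ const c ↓ ctype c
      a-varU  : ∀ i → lookup μ i ≡ U → NoStrict μ → Ψ ∣ μ ⊢ var i ↓ lookup Ψ i
      a-varS  : ∀ i → lookup μ i ≡ S → OnlyStrict μ i → Ψ ∣ μ ⊢ var i ↓ lookup Ψ i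
      a-appU  : ∀ {A B M N} → Ψ ∣ μ ⊢ M ↓ (A ⇒[ lu ] B) →
                Ψ ∣ map strictToU μ ⊢ N ⇑ A → Ψ ∣ μ ⊢ app M lu N ↓ B
      a-app0  : ∀ {A B M N} → Ψ ∣ μ ⊢ M ↓ (A ⇒[ l0 ] B) →
                Ψ ∣ replicate n U ⊢ N ⇑ A → Ψ ∣ μ ⊢ app M l0 N ↓ B
      a-app1  : ∀ {A B M N μM μN} → Split μ μM μN →
                Ψ ∣ μM ⊢ M ↓ (A ⇒[ l1 ] B) → Ψ ∣ μN ⊢ N ⇑ A →
                Ψ ∣ μ ⊢ app M l1 N ↓ B

  data _→whr_ {n : ℕ} : Term n → Term n → Set where
    whr-β   : ∀ {k A M N} → app (lam k A M) k N →whr (M [ N ]₀)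
    whr-app : ∀ {k M Q N} → M →whr Q → app M k N →whr app Q k N

  mutual
    data _⊢_⇑≡_∶_ {n : ℕ} (Ψ : Vec (Ty Atom) n) : Term n → Term n → Ty Atom → Set where
      cv-whr : ∀ {M M′ M″ a} → M →whr M′ → Ψ ⊢ M′ ⇑≡ M″ ∶ atom a → Ψ ⊢ M ⇑≡ M″ ∶ atom a
      cv-atm : ∀ {M N a} → Ψ ⊢ M ↓≡ N ∶ atom a → Ψ ⊢ M ⇑≡ N ∶ atom a
      cv-ext : ∀ {M N k A B} → (A ∷ Ψ) ⊢ app (weaken M) k (var zero) ⇑≡ N ∶ B →
               Ψ ⊢ M ⇑≡ lam k A N ∶ (A ⇒[ k ] B)

    data _⊢_↓≡_∶_ {n : ℕ} (Ψ : Vec (Ty Atom) n) : Term n → Term n → Ty Atom → Set where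
      cv-const : ∀ c → Ψ ⊢ const c ↓≡ const c ∶ ctype c
      cv-var   : ∀ i → Ψ ⊢ var i ↓≡ var i ∶ lookup Ψ i
      cv-app   : ∀ {M N P Q k A B} → Ψ ⊢ M ↓≡ P ∶ (A ⇒[ k ] B) → Ψ ⊢ N ⇑≡ Q ∶ A →
                 Ψ ⊢ app M k N ↓≡ app P k Q ∶ B

{-# OPTIONS --safe #-}
module Submission where

open import Defs
open import Data.Nat using (ℕ; zero; suc)
open import Data.Vec using (Vec; []; _∷_; lookup; map; replicate)
open import Data.Product using (Σ; _×_; _,_; proj₁; proj₂; ∃; ∃₂)
open import Data.Empty using (⊥-elim)
open import Data.Unit using (⊤; tt)
open import Data.Sum using (inj₁; inj₂; [_,_]′)
open import Data.Fin using (Fin; zero; suc; _≟_)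
open import Data.Fin.Properties using (suc-injective)
open import Data.Vec.Properties using (lookup-map; lookup-replicate)
open import Function using (id; _∘_; case_of_)
open import Relation.Nullary using (¬_; Dec; yes; no)
open import Relation.Nullary.Decidable using (map′; _⊎-dec_)
open import Relation.Unary using (Decidable)
import Relation.Binary.PropositionalEquality as ≡
open ≡ using (_≡_; _≢_; refl; sym; trans; cong; cong₂; _≗_)
open ≡.≡-Reasoning

-- Typing in Γ;Ω;Δ is simple typing plus a usage discipline: an irrelevant variable has no relevant
-- occurrence (one outside the arguments of 0-applications), a strict variable occurs strictly (at the
-- head, in function position or in a 1-argument), and every λ imposes the same on its own variable
-- according to its label.  Weak head reduction preserves the discipline, because a 1-redex substitutes
-- its argument at a strict occurrence and a 0-redex substitutes only at irrelevant positions; η-expansion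
-- preserves it as well.  The conversion algorithm terminates on simply typed terms (Kripke logical
-- relation over renamings), and as it only performs weak head steps and η-expansions, the normal form it
-- returns is canonical in Γ;Ω;Δ.

module _ {Sg : Sig} where
  open Sig Sg using (Atom; Const; ctype)

  variable
    m n : ℕ
    Ψ Φ : Vec (Ty Atom) n
    μ : Vec (Mode Sg) n
    M M′ N P : Term Sg n
    A A′ B : Ty Atom
    k : Label
    x : Fin n
    md md′ mdM mdN : Mode Sg

  Typed : Vec (Ty Atom) n → Vec (Mode Sg) n → Term Sg n → Ty Atom → Set
  Typed = _∣_⊢_∶_ Sg

  Canonical : Vec (Ty Atom) n → Vec (Mode Sg) n → Term Sg n → Ty Atom → Set
  Canonical = _∣_⊢_⇑_ Sg

  Atomic : Vec (Ty Atom) n → Vec (Mode Sg) n → Term Sg n → Ty Atom → Set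
  Atomic = _∣_⊢_↓_ Sg

  Conv⇑ : Vec (Ty Atom) n → Term Sg n → Term Sg n → Ty Atom → Set
  Conv⇑ = _⊢_⇑≡_∶_ Sg

  Conv↓ : Vec (Ty Atom) n → Term Sg n → Term Sg n → Ty Atom → Set
  Conv↓ = _⊢_↓≡_∶_ Sg

  _⟶_ : Term Sg n → Term Sg n → Set
  _⟶_ = _→whr_ Sg

  ren : (Fin m → Fin n) → Term Sg m → Term Sg n
  ren = rename Sg

  sub : (Fin m → Term Sg n) → Term Sg m → Term Sg n
  sub = subst Sg

  _[_] : Term Sg (suc n) → Term Sg n → Term Sg n
  M [ N ] = _[_]₀ Sg M N

  _•_ : Term Sg n → (Fin m → Term Sg n) → Fin (suc m) → Term Sg n
  (N • σ) zero    = N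
  (N • σ) (suc i) = σ i

  ext-cong : {ρ ρ′ : Fin m → Fin n} → ρ ≗ ρ′ → ext Sg ρ ≗ ext Sg ρ′
  ext-cong h zero    = refl
  ext-cong h (suc i) = cong suc (h i)

  ren-cong : {ρ ρ′ : Fin m → Fin n} → ρ ≗ ρ′ → ren ρ ≗ ren ρ′
  ren-cong h (const c)   = refl
  ren-cong h (var i)     = cong var (h i)
  ren-cong h (lam k A M) = cong (lam k A) (ren-cong (ext-cong h) M)
  ren-cong h (app M k N) = cong₂ (λ M N → app M k N) (ren-cong h M) (ren-cong h N)

  ren-ren : ∀ {l} (ρ : Fin m → Fin n) (ρ′ : Fin l → Fin m) M →
            ren ρ (ren ρ′ M) ≡ ren (ρ ∘ ρ′) M
  ren-ren ρ ρ′ (const c)   = refl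
  ren-ren ρ ρ′ (var i)     = refl
  ren-ren ρ ρ′ (lam k A M) =
    cong (lam k A) (trans (ren-ren (ext Sg ρ) (ext Sg ρ′) M)
                          (ren-cong (λ { zero → refl ; (suc i) → refl }) M))
  ren-ren ρ ρ′ (app M k N) = cong₂ (λ M N → app M k N) (ren-ren ρ ρ′ M) (ren-ren ρ ρ′ N)

  ren-id : (M : Term Sg n) → ren id M ≡ M
  ren-id (const c)   = refl
  ren-id (var i)     = refl
  ren-id (lam k A M) = cong (lam k A) (trans (ren-cong (λ { zero → refl ; (suc i) → refl }) M) (ren-id M))
  ren-id (app M k N) = cong₂ (λ M N → app M k N) (ren-id M) (ren-id N)

  exts-cong : {σ τ : Fin m → Term Sg n} → σ ≗ τ → exts Sg σ ≗ exts Sg τ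
  exts-cong h zero    = refl
  exts-cong h (suc i) = cong (ren suc) (h i)

  sub-cong : {σ τ : Fin m → Term Sg n} → σ ≗ τ → sub σ ≗ sub τ
  sub-cong h (const c)   = refl
  sub-cong h (var i)     = h i
  sub-cong h (lam k A M) = cong (lam k A) (sub-cong (exts-cong h) M)
  sub-cong h (app M k N) = cong₂ (λ M N → app M k N) (sub-cong h M) (sub-cong h N)

  sub-ren : ∀ {l} (σ : Fin m → Term Sg n) (ρ : Fin l → Fin m) M →
            sub σ (ren ρ M) ≡ sub (σ ∘ ρ) M
  sub-ren σ ρ (const c)   = refl
  sub-ren σ ρ (var i)     = refl
  sub-ren σ ρ (lam k A M) =
    cong (lam k A) (trans (sub-ren (exts Sg σ) (ext Sg ρ) M)
                          (sub-cong (λ { zero → refl ; (suc i) → refl }) M))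
  sub-ren σ ρ (app M k N) = cong₂ (λ M N → app M k N) (sub-ren σ ρ M) (sub-ren σ ρ N)

  ren-sub : ∀ {l} (ρ : Fin m → Fin n) (σ : Fin l → Term Sg m) M →
            ren ρ (sub σ M) ≡ sub (ren ρ ∘ σ) M
  ren-sub ρ σ (const c)   = refl
  ren-sub ρ σ (var i)     = refl
  ren-sub ρ σ (lam k A M) = cong (lam k A) (trans (ren-sub (ext Sg ρ) (exts Sg σ) M) (sub-cong h M))
    where
    h : ren (ext Sg ρ) ∘ exts Sg σ ≗ exts Sg (ren ρ ∘ σ)
    h zero    = refl
    h (suc i) = trans (ren-ren (ext Sg ρ) suc (σ i)) (sym (ren-ren suc ρ (σ i)))
  ren-sub ρ σ (app M k N) = cong₂ (λ M N → app M k N) (ren-sub ρ σ M) (ren-sub ρ σ N)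

  sub-sub : ∀ {l} (τ : Fin m → Term Sg n) (σ : Fin l → Term Sg m) M →
            sub τ (sub σ M) ≡ sub (sub τ ∘ σ) M
  sub-sub τ σ (const c)   = refl
  sub-sub τ σ (var i)     = refl
  sub-sub τ σ (lam k A M) = cong (lam k A) (trans (sub-sub (exts Sg τ) (exts Sg σ) M) (sub-cong h M))
    where
    h : sub (exts Sg τ) ∘ exts Sg σ ≗ exts Sg (sub τ ∘ σ)
    h zero    = refl
    h (suc i) = trans (sub-ren (exts Sg τ) suc (σ i)) (sym (ren-sub suc τ (σ i)))
  sub-sub τ σ (app M k N) = cong₂ (λ M N → app M k N) (sub-sub τ σ M) (sub-sub τ σ N)

  sub-var : (M : Term Sg n) → sub var M ≡ M
  sub-var (const c)   = refl
  sub-var (var i)     = refl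
  sub-var (lam k A M) =
    cong (lam k A) (trans (sub-cong (λ { zero → refl ; (suc i) → refl }) M) (sub-var M))
  sub-var (app M k N) = cong₂ (λ M N → app M k N) (sub-var M) (sub-var N)

  ren-as-sub : ∀ (ρ : Fin m → Fin n) M → ren ρ M ≡ sub (var ∘ ρ) M
  ren-as-sub ρ (const c)   = refl
  ren-as-sub ρ (var i)     = refl
  ren-as-sub ρ (lam k A M) =
    cong (lam k A) (trans (ren-as-sub (ext Sg ρ) M) (sub-cong (λ { zero → refl ; (suc i) → refl }) M))
  ren-as-sub ρ (app M k N) = cong₂ (λ M N → app M k N) (ren-as-sub ρ M) (ren-as-sub ρ N)

  ren-[] : ∀ (ρ : Fin m → Fin n) M N → ren ρ (M [ N ]) ≡ ren (ext Sg ρ) M [ ren ρ N ]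
  ren-[] ρ M N = begin
    ren ρ (M [ N ])                           ≡⟨ ren-sub ρ (subst0 Sg N) M ⟩
    sub (ren ρ ∘ subst0 Sg N) M               ≡⟨ sub-cong (λ { zero → refl ; (suc i) → refl }) M ⟩
    sub (subst0 Sg (ren ρ N) ∘ ext Sg ρ) M    ≡⟨ sub-ren (subst0 Sg (ren ρ N)) (ext Sg ρ) M ⟨
    ren (ext Sg ρ) M [ ren ρ N ]              ∎

  sub-exts-[] : ∀ {l} (ρ : Fin m → Fin n) (σ : Fin l → Term Sg m) M N →
                ren (ext Sg ρ) (sub (exts Sg σ) M) [ N ] ≡ sub (N • (ren ρ ∘ σ)) M
  sub-exts-[] ρ σ M N = begin
    ren (ext Sg ρ) (sub (exts Sg σ) M) [ N ]
      ≡⟨ sub-ren (subst0 Sg N) (ext Sg ρ) (sub (exts Sg σ) M) ⟩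
    sub (subst0 Sg N ∘ ext Sg ρ) (sub (exts Sg σ) M)
      ≡⟨ sub-sub (subst0 Sg N ∘ ext Sg ρ) (exts Sg σ) M ⟩
    sub (sub (subst0 Sg N ∘ ext Sg ρ) ∘ exts Sg σ) M
      ≡⟨ sub-cong h M ⟩
    sub (N • (ren ρ ∘ σ)) M
      ∎
    where
    h : sub (subst0 Sg N ∘ ext Sg ρ) ∘ exts Sg σ ≗ N • (ren ρ ∘ σ)
    h zero    = refl
    h (suc i) = trans (sub-ren _ suc (σ i)) (sym (ren-as-sub ρ (σ i)))

  -- Relevant and strict occurrences

  data _∈ʳ_ : Fin n → Term Sg n → Set where
    here : x ∈ʳ var x
    body : suc x ∈ʳ M → x ∈ʳ lam k A M
    fun  : x ∈ʳ M → x ∈ʳ app M k N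
    arg  : k ≢ l0 → x ∈ʳ N → x ∈ʳ app M k N

  data _∈ˢ_ : Fin n → Term Sg n → Set where
    here : x ∈ˢ var x
    body : suc x ∈ˢ M → x ∈ˢ lam k A M
    fun  : x ∈ˢ M → x ∈ˢ app M k N
    arg  : x ∈ˢ N → x ∈ˢ app M l1 N

  _∈ˢ?_ : (x : Fin n) (M : Term Sg n) → Dec (x ∈ˢ M)
  x ∈ˢ? const c    = no λ ()
  x ∈ˢ? var y      = map′ (λ { refl → here }) (λ { here → refl }) (x ≟ y)
  x ∈ˢ? lam k A M  = map′ body (λ { (body p) → p }) (suc x ∈ˢ? M)
  x ∈ˢ? app M l1 N =
    map′ [ fun , arg ]′ (λ { (fun p) → inj₁ p ; (arg p) → inj₂ p }) (x ∈ˢ? M ⊎-dec x ∈ˢ? N)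
  x ∈ˢ? app M lu N = map′ fun (λ { (fun p) → p }) (x ∈ˢ? M)
  x ∈ˢ? app M l0 N = map′ fun (λ { (fun p) → p }) (x ∈ˢ? M)

  ∈ʳ-ren⁻ : (ρ : Fin m → Fin n) (M : Term Sg m) → x ∈ʳ ren ρ M → ∃ λ y → ρ y ≡ x × y ∈ʳ M
  ∈ʳ-ren⁻ ρ (var y)     here = y , refl , here
  ∈ʳ-ren⁻ ρ (lam k A M) (body p) with ∈ʳ-ren⁻ (ext Sg ρ) M p
  ... | zero  , () , _
  ... | suc y , refl , q = y , refl , body q
  ∈ʳ-ren⁻ ρ (app M k N) (fun p) with ∈ʳ-ren⁻ ρ M p
  ... | y , e , q = y , e , fun q
  ∈ʳ-ren⁻ ρ (app M k N) (arg h p) with ∈ʳ-ren⁻ ρ N p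
  ... | y , e , q = y , e , arg h q

  ∈ˢ-ren : (ρ : Fin m → Fin n) → x ∈ˢ M → ρ x ∈ˢ ren ρ M
  ∈ˢ-ren ρ here     = here
  ∈ˢ-ren ρ (body p) = body (∈ˢ-ren (ext Sg ρ) p)
  ∈ˢ-ren ρ (fun p)  = fun (∈ˢ-ren ρ p)
  ∈ˢ-ren ρ (arg p)  = arg (∈ˢ-ren ρ p)

  zero∉ʳweaken : ¬ zero ∈ʳ weaken Sg M
  zero∉ʳweaken {M = M} p with ∈ʳ-ren⁻ suc M p
  ... | _ , () , _

  ∈ʳ-sub⁻ : (σ : Fin m → Term Sg n) (M : Term Sg m) → x ∈ʳ sub σ M → ∃ λ y → y ∈ʳ M × x ∈ʳ σ y
  ∈ʳ-sub⁻ σ (var y)     p = y , here , p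
  ∈ʳ-sub⁻ σ (lam k A M) (body p) with ∈ʳ-sub⁻ (exts Sg σ) M p
  ... | zero  , _ , ()
  ... | suc y , q , r with ∈ʳ-ren⁻ suc (σ y) r
  ...   | _ , refl , r′ = y , body q , r′
  ∈ʳ-sub⁻ σ (app M k N) (fun p) with ∈ʳ-sub⁻ σ M p
  ... | y , q , r = y , fun q , r
  ∈ʳ-sub⁻ σ (app M k N) (arg h p) with ∈ʳ-sub⁻ σ N p
  ... | y , q , r = y , arg h q , r

  ∈ˢ-sub : ∀ {y} (σ : Fin m → Term Sg n) → y ∈ˢ M → x ∈ˢ σ y → x ∈ˢ sub σ M
  ∈ˢ-sub σ here     q = q
  ∈ˢ-sub σ (body p) q = body (∈ˢ-sub (exts Sg σ) p (∈ˢ-ren suc q))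
  ∈ˢ-sub σ (fun p)  q = fun (∈ˢ-sub σ p q)
  ∈ˢ-sub σ (arg p)  q = arg (∈ˢ-sub σ p q)

  -- Typing in Γ;Ω;Δ as usage-respecting simple typing

  Respects : Mode Sg → Fin n → Term Sg n → Set
  Respects U x M = ⊤
  Respects I x M = ¬ x ∈ʳ M
  Respects S x M = x ∈ˢ M

  -- A record rather than a Π-type, so that μ can be inferred from it.
  record RespectsAll (μ : Vec (Mode Sg) n) (M : Term Sg n) : Set where
    field respectsAt : ∀ x → Respects (lookup μ x) x M
  open RespectsAll

  data _⊢_∶_ (Ψ : Vec (Ty Atom) n) : Term Sg n → Ty Atom → Set where
    ⊢const : ∀ c → Ψ ⊢ const c ∶ ctype c
    ⊢var   : ∀ i → Ψ ⊢ var i ∶ lookup Ψ i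
    ⊢lam   : (A ∷ Ψ) ⊢ M ∶ B → Respects (modeOf Sg k) zero M → Ψ ⊢ lam k A M ∶ (A ⇒[ k ] B)
    ⊢app   : Ψ ⊢ M ∶ (A ⇒[ k ] B) → Ψ ⊢ N ∶ A → Ψ ⊢ app M k N ∶ B

  _∶_⇒ʳ_ : (Fin m → Fin n) → Vec (Ty Atom) m → Vec (Ty Atom) n → Set
  ρ ∶ Ψ ⇒ʳ Φ = ∀ i → lookup Φ (ρ i) ≡ lookup Ψ i

  ext-⇒ʳ : {ρ : Fin m → Fin n} → ρ ∶ Ψ ⇒ʳ Φ → ext Sg ρ ∶ (A ∷ Ψ) ⇒ʳ (A ∷ Φ)
  ext-⇒ʳ ok zero    = refl
  ext-⇒ʳ ok (suc i) = ok i

  respects-ren : (ρ : Fin m → Fin n) → (∀ {y} → ρ y ≡ ρ x → y ≡ x) →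
                 Respects md x M → Respects md (ρ x) (ren ρ M)
  respects-ren {md = U} ρ inj r = tt
  respects-ren {md = I} {M = M} ρ inj r p with ∈ʳ-ren⁻ ρ M p
  ... | y , e , q with inj e
  ...   | refl = r q
  respects-ren {md = S} ρ inj r = ∈ˢ-ren ρ r

  respects-exts : (σ : Fin m → Term Sg n) → Respects md zero M → Respects md zero (sub (exts Sg σ) M)
  respects-exts {md = U} σ r = tt
  respects-exts {md = I} {M = M} σ r p with ∈ʳ-sub⁻ (exts Sg σ) M p
  ... | zero  , q , _ = r q
  ... | suc y , _ , s = zero∉ʳweaken s
  respects-exts {md = S} σ r = ∈ˢ-sub (exts Sg σ) r here

  ⊢-ren : (ρ : Fin m → Fin n) → ρ ∶ Ψ ⇒ʳ Φ → Ψ ⊢ M ∶ A → Φ ⊢ ren ρ M ∶ A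
  ⊢-ren ρ ok (⊢const c) = ⊢const c
  ⊢-ren {Φ = Φ} ρ ok (⊢var i) = ≡.subst (Φ ⊢ var (ρ i) ∶_) (ok i) (⊢var (ρ i))
  ⊢-ren ρ ok (⊢lam d r) =
    ⊢lam (⊢-ren (ext Sg ρ) (ext-⇒ʳ ok) d)
         (respects-ren (ext Sg ρ) (λ { {zero} _ → refl ; {suc _} () }) r)
  ⊢-ren ρ ok (⊢app d e) = ⊢app (⊢-ren ρ ok d) (⊢-ren ρ ok e)

  ⊢-sub : (σ : Fin m → Term Sg n) → (∀ i → Φ ⊢ σ i ∶ lookup Ψ i) → Ψ ⊢ M ∶ A → Φ ⊢ sub σ M ∶ A
  ⊢-sub σ ⊢σ (⊢const c) = ⊢const c
  ⊢-sub σ ⊢σ (⊢var i)   = ⊢σ i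
  ⊢-sub σ ⊢σ (⊢lam d r) = ⊢lam (⊢-sub (exts Sg σ) ⊢exts d) (respects-exts σ r)
    where
    ⊢exts : ∀ i → _ ⊢ exts Sg σ i ∶ lookup (_ ∷ _) i
    ⊢exts zero    = ⊢var zero
    ⊢exts (suc i) = ⊢-ren suc (λ _ → refl) (⊢σ i)
  ⊢-sub σ ⊢σ (⊢app d e) = ⊢app (⊢-sub σ ⊢σ d) (⊢-sub σ ⊢σ e)

  ⊢-whr : Ψ ⊢ M ∶ A → M ⟶ M′ → Ψ ⊢ M′ ∶ A
  ⊢-whr {Ψ = Ψ} (⊢app (⊢lam {A = A} d _) e) whr-β = ⊢-sub _ ⊢subst0 d
    where
    ⊢subst0 : ∀ i → Ψ ⊢ subst0 Sg _ i ∶ lookup (A ∷ Ψ) i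
    ⊢subst0 zero    = e
    ⊢subst0 (suc i) = ⊢var i
  ⊢-whr (⊢app d e) (whr-app w) = ⊢app (⊢-whr d w) e

  relevant-label : Respects (modeOf Sg k) x M → x ∈ʳ M → k ≢ l0
  relevant-label {k = l0} r p = ⊥-elim (r p)
  relevant-label {k = l1} r p = λ ()
  relevant-label {k = lu} r p = λ ()

  ∈ʳ-whr⁻ : Ψ ⊢ M ∶ A → M ⟶ M′ → x ∈ʳ M′ → x ∈ʳ M
  ∈ʳ-whr⁻ (⊢app (⊢lam {M = M} _ r) _) (whr-β {N = N}) p with ∈ʳ-sub⁻ (subst0 Sg N) M p
  ... | zero  , q , s    = arg (relevant-label r q) s
  ... | suc y , q , here = fun (body q)
  ∈ʳ-whr⁻ (⊢app d _) (whr-app w) (fun p)   = fun (∈ʳ-whr⁻ d w p)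
  ∈ʳ-whr⁻ _          (whr-app w) (arg h p) = arg h p

  ∈ˢ-whr : Ψ ⊢ M ∶ A → M ⟶ M′ → x ∈ˢ M → x ∈ˢ M′
  ∈ˢ-whr (⊢app (⊢lam _ _) _) whr-β (fun (body p)) = ∈ˢ-sub _ p here
  ∈ˢ-whr (⊢app (⊢lam _ r) _) whr-β (arg p)        = ∈ˢ-sub _ r p
  ∈ˢ-whr (⊢app d _) (whr-app w) (fun p) = fun (∈ˢ-whr d w p)
  ∈ˢ-whr _          (whr-app w) (arg p) = arg p

  respects-whr : Ψ ⊢ M ∶ A → M ⟶ M′ → Respects md x M → Respects md x M′
  respects-whr {md = U} d w r = tt
  respects-whr {md = I} d w r = r ∘ ∈ʳ-whr⁻ d w
  respects-whr {md = S} d w r = ∈ˢ-whr d w r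

  respects-cong : md ≡ md′ → Respects md x M → Respects md′ x M
  respects-cong refl r = r

  respects-at : RespectsAll μ M → ∀ x → lookup μ x ≡ md → Respects md x M
  respects-at r x e = respects-cong e (respectsAt r x)

  respects-body : Respects md (suc x) M → Respects md x (lam k A M)
  respects-body {md = U} r = tt
  respects-body {md = I} r = λ { (body p) → r p }
  respects-body {md = S} r = body r

  respects-body⁻ : Respects md x (lam k A M) → Respects md (suc x) M
  respects-body⁻ {md = U} r = tt
  respects-body⁻ {md = I} r = r ∘ body
  respects-body⁻ {md = S} (body p) = p

  respects-appᵘ : Respects md x M → Respects (strictToU Sg md) x N → Respects md x (app M lu N)
  respects-appᵘ {md = U} rM rN = tt
  respects-appᵘ {md = I} rM rN = λ { (fun p) → rM p ; (arg _ p) → rN p }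
  respects-appᵘ {md = S} rM rN = fun rM

  respects-appᵘ⁻ : Respects md x (app M lu N) → Respects md x M × Respects (strictToU Sg md) x N
  respects-appᵘ⁻ {md = U} r       = tt , tt
  respects-appᵘ⁻ {md = I} r       = r ∘ fun , r ∘ arg (λ ())
  respects-appᵘ⁻ {md = S} (fun p) = p , tt

  respects-app⁰ : Respects md x M → Respects md x (app M l0 N)
  respects-app⁰ {md = U} rM = tt
  respects-app⁰ {md = I} rM = λ { (fun p) → rM p ; (arg h _) → h refl }
  respects-app⁰ {md = S} rM = fun rM

  respects-app⁰⁻ : Respects md x (app M l0 N) → Respects md x M
  respects-app⁰⁻ {md = U} r       = tt
  respects-app⁰⁻ {md = I} r       = r ∘ fun
  respects-app⁰⁻ {md = S} (fun p) = p

  respects-app¹ : SplitM Sg md mdM mdN → Respects mdM x M → Respects mdN x N → Respects md x (app M l1 N)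
  respects-app¹ sU  rM rN = tt
  respects-app¹ sI  rM rN = λ { (fun p) → rM p ; (arg _ p) → rN p }
  respects-app¹ sSL rM rN = fun rM
  respects-app¹ sSR rM rN = arg rN

  respects-app¹⁻ : SplitM Sg md mdM mdN → (mdM ≡ S → x ∈ˢ M) → (mdN ≡ S → ¬ x ∈ˢ M) →
                   Respects md x (app M l1 N) → Respects mdM x M × Respects mdN x N
  respects-app¹⁻ sU  l r s       = tt , tt
  respects-app¹⁻ sI  l r s       = s ∘ fun , s ∘ arg (λ ())
  respects-app¹⁻ sSL l r s       = l refl , tt
  respects-app¹⁻ sSR l r (fun p) = ⊥-elim (r refl p)
  respects-app¹⁻ sSR l r (arg p) = tt , p

  lookup-split : ∀ {μM μN : Vec (Mode Sg) n} → Split Sg μ μM μN → ∀ x →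
                 SplitM Sg (lookup μ x) (lookup μM x) (lookup μN x)
  lookup-split (s ∷ sp) zero    = s
  lookup-split (s ∷ sp) (suc x) = lookup-split sp x

  splitMode : {X : Set} (md : Mode Sg) → Dec X →
              ∃₂ λ mdM mdN → SplitM Sg md mdM mdN × (mdM ≡ S → X) × (mdN ≡ S → ¬ X)
  splitMode U _        = U , U , sU , (λ ()) , (λ ())
  splitMode I _        = I , I , sI , (λ ()) , (λ ())
  splitMode S (yes p)  = S , U , sSL , (λ _ → p) , (λ ())
  splitMode S (no ¬p)  = U , S , sSR , (λ ()) , (λ _ → ¬p)

  strictSplit : {P : Fin n → Set} → Decidable P → (μ : Vec (Mode Sg) n) →
                ∃₂ λ μM μN → Split Sg μ μM μN × (∀ x → lookup μM x ≡ S → P x)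
                                              × (∀ x → lookup μN x ≡ S → ¬ P x)
  strictSplit P? []      = [] , [] , [] , (λ ()) , (λ ())
  strictSplit P? (md ∷ μ) with splitMode md (P? zero) | strictSplit (P? ∘ suc) μ
  ... | mdM , mdN , s , l , r | μM , μN , sp , ls , rs =
    mdM ∷ μM , mdN ∷ μN , s ∷ sp ,
    (λ { zero → l ; (suc x) → ls x }) , (λ { zero → r ; (suc x) → rs x })

  respects-const : ∀ {c} → NoStrict Sg μ → RespectsAll μ (const c)
  respects-const {μ = μ} ns .respectsAt x with lookup μ x in e
  ... | U = tt
  ... | I = λ ()
  ... | S = ⊥-elim (ns x e)

  respects-var : ∀ {i} → OnlyStrict Sg μ i → lookup μ i ≢ I → RespectsAll μ (var i)
  respects-var {μ = μ} {i} only notI .respectsAt x with lookup μ x in e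
  ... | U = tt
  ... | I = λ { here → notI e }
  ... | S = ≡.subst (_∈ˢ var i) (sym (only x e)) here

  typed-respects : Typed Ψ μ M A → RespectsAll μ M
  typed-respects (t-const c ns)  = respects-const ns
  typed-respects (t-varU i e ns) =
    respects-var (λ x ex → ⊥-elim (ns x ex)) (λ eI → case trans (sym e) eI of λ ())
  typed-respects (t-varS i e os) = respects-var os (λ eI → case trans (sym e) eI of λ ())
  typed-respects (t-lam d) .respectsAt x = respects-body (respectsAt (typed-respects d) (suc x))
  typed-respects {μ = μ} (t-appU d e) .respectsAt x =
    respects-appᵘ (respectsAt (typed-respects d) x)
                  (respects-cong (lookup-map x (strictToU Sg) μ) (respectsAt (typed-respects e) x))
  typed-respects (t-app0 d e) .respectsAt x = respects-app⁰ (respectsAt (typed-respects d) x)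
  typed-respects (t-app1 sp d e) .respectsAt x =
    respects-app¹ (lookup-split sp x) (respectsAt (typed-respects d) x) (respectsAt (typed-respects e) x)

  erase : Typed Ψ μ M A → Ψ ⊢ M ∶ A
  erase (t-const c _)   = ⊢const c
  erase (t-varU i _ _)  = ⊢var i
  erase (t-varS i _ _)  = ⊢var i
  erase (t-lam d)       = ⊢lam (erase d) (respectsAt (typed-respects d) zero)
  erase (t-appU d e)    = ⊢app (erase d) (erase e)
  erase (t-app0 d e)    = ⊢app (erase d) (erase e)
  erase (t-app1 _ d e)  = ⊢app (erase d) (erase e)

  noStrict-const : ∀ {c} → RespectsAll μ (const c) → NoStrict Sg μ
  noStrict-const r x e with respects-at r x e
  ... | ()

  noStrict-var : ∀ {i} → RespectsAll μ (var i) → lookup μ i ≡ U → NoStrict Sg μ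
  noStrict-var r eU x e with respects-at r x e
  ... | here = case trans (sym eU) e of λ ()

  onlyStrict-var : ∀ {i} → RespectsAll μ (var i) → OnlyStrict Sg μ i
  onlyStrict-var r x e with respects-at r x e
  ... | here = refl

  typed : Ψ ⊢ M ∶ A → RespectsAll μ M → Typed Ψ μ M A
  typed (⊢const c) r = t-const c (noStrict-const r)
  typed {μ = μ} (⊢var i) r with lookup μ i in e
  ... | U = t-varU i e (noStrict-var r e)
  ... | I = ⊥-elim (respects-at r i e here)
  ... | S = t-varS i e (onlyStrict-var r)
  typed {μ = μ} (⊢lam {M = M} {k = k} d l) r = t-lam (typed d r′)
    where
    r′ : RespectsAll (modeOf Sg k ∷ μ) M
    r′ .respectsAt zero    = l
    r′ .respectsAt (suc x) = respects-body⁻ (respectsAt r x)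
  typed {μ = μ} (⊢app {k = lu} {N = N} d e) r = t-appU (typed d rM) (typed e rN)
    where
    rM : RespectsAll μ _
    rM .respectsAt x = proj₁ (respects-appᵘ⁻ (respectsAt r x))
    rN : RespectsAll (map (strictToU Sg) μ) N
    rN .respectsAt x =
      respects-cong (sym (lookup-map x (strictToU Sg) μ)) (proj₂ (respects-appᵘ⁻ (respectsAt r x)))
  typed {μ = μ} (⊢app {k = l0} {N = N} d e) r = t-app0 (typed d rM) (typed e rN)
    where
    rM : RespectsAll μ _
    rM .respectsAt x = respects-app⁰⁻ (respectsAt r x)
    rN : RespectsAll (replicate _ U) N
    rN .respectsAt x = respects-cong (sym (lookup-replicate x U)) tt
  typed {μ = μ} (⊢app {M = M} {k = l1} {N = N} d e) r with strictSplit (_∈ˢ? M) μ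
  ... | μM , μN , sp , l , r′ = t-app1 sp (typed d rM) (typed e rN)
    where
    split-respects : ∀ x → Respects (lookup μM x) x M × Respects (lookup μN x) x N
    split-respects x = respects-app¹⁻ (lookup-split sp x) (l x) (r′ x) (respectsAt r x)
    rM : RespectsAll μM M
    rM .respectsAt = proj₁ ∘ split-respects
    rN : RespectsAll μN N
    rN .respectsAt = proj₂ ∘ split-respects

  typed-whr : Typed Ψ μ M A → M ⟶ M′ → Typed Ψ μ M′ A
  typed-whr d w = typed (⊢-whr (erase d) w) r
    where
    r : RespectsAll _ _
    r .respectsAt = respects-whr (erase d) w ∘ respectsAt (typed-respects d)

  respects-app-var : ∀ {y} → x ≢ y → Respects md x M → Respects md x (app M k (var y))
  respects-app-var {md = U} x≢y r = tt
  respects-app-var {md = I} x≢y r = λ { (fun p) → r p ; (arg _ here) → x≢y refl }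
  respects-app-var {md = S} x≢y r = fun r

  respects-η : RespectsAll μ M → RespectsAll (modeOf Sg k ∷ μ) (app (weaken Sg M) k (var zero))
  respects-η {k = lu} r .respectsAt zero = tt
  respects-η {k = l0} r .respectsAt zero = λ { (fun p) → zero∉ʳweaken p ; (arg h _) → h refl }
  respects-η {k = l1} r .respectsAt zero = arg here
  respects-η r .respectsAt (suc x) = respects-app-var (λ ()) (respects-ren suc suc-injective (respectsAt r x))

  typed-η : Typed Ψ μ M (A ⇒[ k ] B) →
            Typed (A ∷ Ψ) (modeOf Sg k ∷ μ) (app (weaken Sg M) k (var zero)) B
  typed-η d =
    typed (⊢app (⊢-ren suc (λ _ → refl) (erase d)) (⊢var zero)) (respects-η (typed-respects d))

  -- Termination of algorithmic conversion

  ⟶-ren : (ρ : Fin m → Fin n) → M ⟶ M′ → ren ρ M ⟶ ren ρ M′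
  ⟶-ren ρ (whr-β {M = M} {N}) = ≡.subst (ren ρ (app (lam _ _ M) _ N) ⟶_) (sym (ren-[] ρ M N)) whr-β
  ⟶-ren ρ (whr-app w) = whr-app (⟶-ren ρ w)

  mutual
    conv⇑-ren : (ρ : Fin m → Fin n) → ρ ∶ Ψ ⇒ʳ Φ → Conv⇑ Ψ M N A → Conv⇑ Φ (ren ρ M) (ren ρ N) A
    conv⇑-ren ρ ok (cv-whr w c) = cv-whr (⟶-ren ρ w) (conv⇑-ren ρ ok c)
    conv⇑-ren ρ ok (cv-atm c)   = cv-atm (conv↓-ren ρ ok c)
    conv⇑-ren {Φ = Φ} ρ ok (cv-ext {M = M} {N} {k} {A} c) =
      cv-ext (≡.subst (λ X → Conv⇑ (A ∷ Φ) (app X k (var zero)) (ren (ext Sg ρ) N) _) ext-weaken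
                      (conv⇑-ren (ext Sg ρ) (ext-⇒ʳ ok) c))
      where
      ext-weaken : ren (ext Sg ρ) (weaken Sg M) ≡ weaken Sg (ren ρ M)
      ext-weaken = trans (ren-ren (ext Sg ρ) suc M) (sym (ren-ren suc ρ M))

    conv↓-ren : (ρ : Fin m → Fin n) → ρ ∶ Ψ ⇒ʳ Φ → Conv↓ Ψ M N A → Conv↓ Φ (ren ρ M) (ren ρ N) A
    conv↓-ren ρ ok (cv-const c) = cv-const c
    conv↓-ren {Φ = Φ} ρ ok (cv-var i) = ≡.subst (Conv↓ Φ (var (ρ i)) (var (ρ i))) (ok i) (cv-var (ρ i))
    conv↓-ren ρ ok (cv-app c d) = cv-app (conv↓-ren ρ ok c) (conv⇑-ren ρ ok d)

  _⊨_∶_ : Vec (Ty Atom) n → Term Sg n → Ty Atom → Set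
  Ψ ⊨ M ∶ atom a = ∃ λ N → Conv⇑ Ψ M N (atom a)
  _⊨_∶_ {n} Ψ M (A ⇒[ k ] B) =
    ∀ {m} {Φ : Vec (Ty Atom) m} (ρ : Fin n → Fin m) → ρ ∶ Ψ ⇒ʳ Φ →
    ∀ {N} → Φ ⊨ N ∶ A → Φ ⊨ app (ren ρ M) k N ∶ B

  mutual
    reify : ∀ A → Ψ ⊨ M ∶ A → ∃ λ N → Conv⇑ Ψ M N A
    reify (atom a) r = r
    reify {Ψ = Ψ} (A ⇒[ k ] B) r =
      let N , c = reify B (r {Φ = A ∷ Ψ} suc (λ _ → refl) (reflect A (cv-var zero)))
      in  lam k A N , cv-ext c

    reflect : ∀ A → Conv↓ Ψ M P A → Ψ ⊨ M ∶ A
    reflect (atom a)     c = _ , cv-atm c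
    reflect (A ⇒[ k ] B) c ρ ok r = reflect B (cv-app (conv↓-ren ρ ok c) (proj₂ (reify A r)))

  ⊨-ren : (ρ : Fin m → Fin n) → ρ ∶ Ψ ⇒ʳ Φ → ∀ A → Ψ ⊨ M ∶ A → Φ ⊨ ren ρ M ∶ A
  ⊨-ren ρ ok (atom a) (N , c) = ren ρ N , conv⇑-ren ρ ok c
  ⊨-ren {M = M} ρ ok (A ⇒[ k ] B) r {Φ = Φ′} ρ′ ok′ {N} rN =
    ≡.subst (λ X → Φ′ ⊨ app X k N ∶ B) (sym (ren-ren ρ′ ρ M))
            (r (ρ′ ∘ ρ) (λ i → trans (ok′ (ρ i)) (ok i)) rN)

  ⊨-expand : ∀ A → M ⟶ M′ → Ψ ⊨ M′ ∶ A → Ψ ⊨ M ∶ A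
  ⊨-expand (atom a)     w (N , c) = N , cv-whr w c
  ⊨-expand (A ⇒[ k ] B) w r ρ ok rN = ⊨-expand B (whr-app (⟶-ren ρ w)) (r ρ ok rN)

  fundamental : Ψ ⊢ M ∶ A → (σ : Fin n → Term Sg m) → (∀ i → Φ ⊨ σ i ∶ lookup Ψ i) →
                Φ ⊨ sub σ M ∶ A
  fundamental (⊢const c) σ ⊨σ = reflect (ctype c) (cv-const c)
  fundamental (⊢var i)   σ ⊨σ = ⊨σ i
  fundamental (⊢lam {A = A} {M = M} {B = B} d _) σ ⊨σ {Φ = Φ′} ρ ok {N} ⊨N =
    ⊨-expand B whr-β (≡.subst (λ X → Φ′ ⊨ X ∶ B) (sym (sub-exts-[] ρ σ M N))
                              (fundamental d (N • (ren ρ ∘ σ)) ⊨τ))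
    where
    ⊨τ : ∀ i → Φ′ ⊨ (N • (ren ρ ∘ σ)) i ∶ lookup (A ∷ _) i
    ⊨τ zero    = ⊨N
    ⊨τ (suc i) = ⊨-ren ρ ok _ (⊨σ i)
  fundamental {Φ = Φ} (⊢app {k = k} {B = B} {N = N} d e) σ ⊨σ =
    ≡.subst (λ X → Φ ⊨ app X k (sub σ N) ∶ B) (ren-id _)
            (fundamental d σ ⊨σ id (λ _ → refl) (fundamental e σ ⊨σ))

  normalise : Ψ ⊢ M ∶ A → ∃ λ N → Conv⇑ Ψ M N A
  normalise {Ψ = Ψ} {M = M} {A = A} d =
    reify A (≡.subst (λ X → Ψ ⊨ X ∶ A) (sub-var M)
                     (fundamental d var (λ i → reflect (lookup Ψ i) (cv-var i))))

  mutual
    canonical : Typed Ψ μ M A → Conv⇑ Ψ M N A → Canonical Ψ μ N A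
    canonical d (cv-whr w c) = canonical (typed-whr d w) c
    canonical d (cv-ext c)   = c-lam (canonical (typed-η d) c)
    canonical d (cv-atm c) with atomic d c
    ... | refl , a = c-atm a

    -- Conv↓ synthesises the type of M, so it agrees with the one assigned by the derivation.
    atomic : Typed Ψ μ M A′ → Conv↓ Ψ M P A → A ≡ A′ × Atomic Ψ μ P A
    atomic (t-const c ns)  (cv-const .c) = refl , a-const c ns
    atomic (t-varU i e ns) (cv-var .i)   = refl , a-varU i e ns
    atomic (t-varS i e os) (cv-var .i)   = refl , a-varS i e os
    atomic (t-appU d e) (cv-app c q) with atomic d c
    ... | refl , a = refl , a-appU a (canonical e q)
    atomic (t-app0 d e) (cv-app c q) with atomic d c
    ... | refl , a = refl , a-app0 a (canonical e q)
    atomic (t-app1 sp d e) (cv-app c q) with atomic d c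
    ... | refl , a = refl , a-app1 sp a (canonical e q)

theorem4p9 : (Sg : Sig) {n : ℕ} (Ψ : Vec (Ty (Sig.Atom Sg)) n) (μ : Vec (Mode Sg) n)
             (M : Term Sg n) (A : Ty (Sig.Atom Sg)) →
             _∣_⊢_∶_ Sg Ψ μ M A →
             Σ (Term Sg n) (λ N → _⊢_⇑≡_∶_ Sg Ψ M N A × _∣_⊢_⇑_ Sg Ψ μ N A)
theorem4p9 Sg Ψ μ M A d = let N , c = normalise (erase d) in N , c , canonical d c
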